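{- Let $\mathcal{H}\subseteq 2^V$ be a hypergraph. If $\mathcal H$ is a JM hypergraph, then $\mathcal H$ is minimal transversal-free.
   Context: Let $V=\{1,\dots,n\}$. A hypergraph is a family $\mathcal H\subseteq 2^V$ with $\mathcal H\neq\emptyset$, $\emptyset\notin\mathcal H$, $V=\bigcup_{H\in\mathcal H}H$. The game $NIM_{\mathcal H}$ is played on positions $x\in\mathbb{Z}_{\ge 0}^V$; a move ($H$-move) $x\to x'$ chooses $H\in\mathcal H$ and goes to any $x'\in\mathbb Z_{\ge0}^V$ with $x'_i<x_i$ for $i\in H$ and $x'_i=x_i$ for $i\notin H$. Players alternate; the player who cannot move loses. The Sprague–Grundy function is $\mathcal G_{\mathcal H}(x)=\mathrm{mex}\{\mathcal G_{\mathcal H}(x') : x\to x' \text{ a move}\}$ ($\mathrm{mex}(S)$ = least nonnegative integer not in $S$). The height $h_{\mathcal H}(x)$ is the maximum number of consecutive moves possible from $x$. With $e$ the all-ones vector, $m(x)=\min_{i}x_i$, $y_{\mathcal H}(x)=h_{\mathcal H}(x-m(x)e)+1$, $v_{\mathcal H}(x)=\binom{y_{\mathcal H}(x)}{2}+\big((m(x)-\binom{y_{\mathcal H}(x)}{2}-1)\bmod y_{\mathcal H}(x)\big)$ (residue in $\{0,\dots,y_{\mathcal H}(x)-1\}$), and $f_{\mathcal H}(x)=h_{\mathcal H}(x)$ if $m(x)\le\binom{y_{\mathcal H}(x)}{2}$, else $f_{\mathcal H}(x)=v_{\mathcal H}(x)$. $\mathcal H$ is JM if $\mathcal G_{\mathcal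 H}=f_{\mathcal H}$ on $\mathbb Z_{\ge0}^V$. A set $T\subseteq V$ is a transversal of $\mathcal H$ if $T\cap H\neq\emptyset$ for all $H\in\mathcal H$. $\mathcal H$ is transversal-free if no hyperedge of $\mathcal H$ is a transversal of $\mathcal H$. For $S\subseteq V$, the induced subhypergraph is $\mathcal H_S=\{H\in\mathcal H: H\subseteq S\}$. $\mathcal H$ is minimal transversal-free if it is transversal-free while for every proper subset $S\subsetneq V$ with $\mathcal H_S\neq\emptyset$, $\mathcal H_S$ is not transversal-free (i.e., some hyperedge of $\mathcal H_S$ meets all hyperedges of $\mathcal H_S$). -}

module Defs where

open import Data.Nat using (ℕ; zero; suc; _+_; _∸_; _<_; _≤_; _⊓_; _≤ᵇ_)
open import Data.Nat.DivMod using (_%_)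
open import Data.Nat.Combinatorics using (_C_)
open import Data.Bool using (if_then_else_)
open import Data.Fin using (Fin)
import Data.Fin as F
open import Data.Fin.Subset.Properties using (_⊆?_)
open import Data.Fin.Subset as Sub using (Subset; _∈_; _∉_; _⊆_; _⊂_; _∩_; Nonempty)
open import Data.List using (List; filter)
open import Data.List.Membership.Propositional using () renaming (_∈_ to _∈ᴸ_)
open import Data.Product using (Σ; ∃; _×_; _,_)
open import Relation.Nullary using (¬_)
open import Relation.Binary.PropositionalEquality using (_≡_; _≢_)

-- Vertex set V = Fin n; a family of subsets of V is a (finite) list of subsets.
Family : ℕ → Set
Family n = List (Subset n)

record IsHypergraph {n : ℕ} (ℋ : Family n) : Set where
  field
    nonempty : ∃ λ E → E ∈ᴸ ℋ
    noEmptyEdge : ¬ (Sub.⊥ ∈ᴸ ℋ)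
    covers : ∀ (i : Fin n) → ∃ λ E → E ∈ᴸ ℋ × i ∈ E

Pos : ℕ → Set
Pos n = Fin n → ℕ

Move : ∀ {n} → Family n → Pos n → Pos n → Set
Move {n} ℋ x x' = ∃ λ E → E ∈ᴸ ℋ
  × (∀ (i : Fin n) → i ∈ E → x' i < x i)
  × (∀ (i : Fin n) → i ∉ E → x' i ≡ x i)

-- g is the Sprague–Grundy function: g x = mex { g x' | x → x' }.
IsSG : ∀ {n} → Family n → (Pos n → ℕ) → Set
IsSG ℋ g = ∀ x →
  (∀ x' → Move ℋ x x' → g x' ≢ g x)
  × (∀ k → k < g x → ∃ λ x' → Move ℋ x x' × g x' ≡ k)

data Play {n} (ℋ : Family n) : Pos n → ℕ → Set where
  stop : ∀ {x} → Play ℋ x 0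
  step : ∀ {x x' k} → Move ℋ x x' → Play ℋ x' k → Play ℋ x (suc k)

IsHeight : ∀ {n} → Family n → (Pos n → ℕ) → Set
IsHeight ℋ h = ∀ x → Play ℋ x (h x) × (∀ k → Play ℋ x k → k ≤ h x)

minFrom : ∀ {n} → ℕ → (Fin n → ℕ) → ℕ
minFrom {zero} a x = a
minFrom {suc n} a x = minFrom (a ⊓ x F.zero) (λ i → x (F.suc i))

mn : ∀ {n} → Pos n → ℕ
mn {zero} x = 0
mn {suc n} x = minFrom (x F.zero) (λ i → x (F.suc i))

fH : ∀ {n} → (Pos n → ℕ) → Pos n → ℕ
fH h x =
  let m = mn x
      y = suc (h (λ i → x i ∸ m))
      c = y C 2
      v = c + ((m ∸ c ∸ 1) % y)
  in if m ≤ᵇ c then h x else v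

JM : ∀ {n} → Family n → Set
JM {n} ℋ = ∃ λ (G : Pos n → ℕ) → ∃ λ (h : Pos n → ℕ) →
  IsSG ℋ G × IsHeight ℋ h × (∀ x → G x ≡ fH h x)

IsTransversal : ∀ {n} → Family n → Subset n → Set
IsTransversal ℋ T = ∀ H → H ∈ᴸ ℋ → Nonempty (T ∩ H)

TransversalFree : ∀ {n} → Family n → Set
TransversalFree ℋ = ¬ (∃ λ H → H ∈ᴸ ℋ × IsTransversal ℋ H)

Induced : ∀ {n} → Family n → Subset n → Family n
Induced ℋ S = filter (λ H → H ⊆? S) ℋ

MinimalTransversalFree : ∀ {n} → Family n → Set
MinimalTransversalFree {n} ℋ = TransversalFree ℋ
  × (∀ (S : Subset n) → S ⊂ Sub.⊤ → (∃ λ H → H ∈ᴸ Induced ℋ S)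
       → ¬ TransversalFree (Induced ℋ S))

module Submission where

-- The JM formula f_ℋ is only evaluated at two kinds of positions:
--   * positions with a zero coordinate (m(x) = 0), where f_ℋ(x) = h_ℋ(x), so
--     the Sprague–Grundy value vanishes exactly at terminal positions;
--   * the all-ones position e, where m(e) = 1 and y(e) = h(0) + 1; if the
--     zero position is terminal then y(e) = 1 and f_ℋ(e) = v(e) = 0.
-- Transversal-freeness: if a hyperedge H were a transversal, the move from e
-- that empties H reaches a terminal position (every hyperedge meets the zeros
-- on H), which has value 0 = G(e); impossible for a Sprague–Grundy function.
-- Minimality: for S ≠ V with ℋ_S ≠ ∅, the indicator position 1_S has a zero
-- coordinate and a move, so G(1_S) > 0 and some move along an edge E reaches
-- a terminal position. Then E ⊆ S, and E meets every hyperedge of ℋ_S, since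
-- an edge of ℋ_S avoiding E would still be all ones and thus movable.

open import Defs
open import Data.Nat using (ℕ; zero; suc; _<_; _≤_; _⊓_; z≤n; s≤s)
open import Data.Nat.Properties using (≤-refl; ≤-trans; m⊓n≤m; m⊓n≤n; ⊓-idem; n≤0⇒n≡0; n≮0; <-≤-trans)
open import Data.Fin using (Fin)
import Data.Fin as F
open import Data.Fin.Subset using (Subset; _∈_; _∉_; _⊆_; _⊂_; ⊤; _∩_)
open import Data.Fin.Subset.Properties using (_∈?_; _⊆?_; nonempty?; x∈p∩q⁺; x∈p∩q⁻)
open import Data.List.Membership.Propositional using () renaming (_∈_ to _∈ᴸ_)
open import Data.List.Membership.Propositional.Properties using (∈-filter⁺; ∈-filter⁻)
open import Data.Product using (∃; _×_; _,_; proj₁; proj₂)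
open import Data.Empty using (⊥-elim)
open import Relation.Nullary using (¬_; yes; no)
open import Relation.Binary.PropositionalEquality using (_≡_; refl; sym; trans; subst)

minFrom-≤-seed : ∀ {n} a (x : Fin n → ℕ) → minFrom a x ≤ a
minFrom-≤-seed {zero} a x = ≤-refl
minFrom-≤-seed {suc n} a x =
  ≤-trans (minFrom-≤-seed (a ⊓ x F.zero) (λ i → x (F.suc i))) (m⊓n≤m a _)

minFrom-≤-entry : ∀ {n} a (x : Fin n → ℕ) j → minFrom a x ≤ x j
minFrom-≤-entry {suc n} a x F.zero =
  ≤-trans (minFrom-≤-seed (a ⊓ x F.zero) (λ i → x (F.suc i))) (m⊓n≤n a _)
minFrom-≤-entry {suc n} a x (F.suc j) = minFrom-≤-entry (a ⊓ x F.zero) (λ i → x (F.suc i)) j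

mn-≤ : ∀ {n} (x : Pos n) j → mn x ≤ x j
mn-≤ {suc n} x F.zero = minFrom-≤-seed (x F.zero) (λ i → x (F.suc i))
mn-≤ {suc n} x (F.suc j) = minFrom-≤-entry (x F.zero) (λ i → x (F.suc i)) j

mn-zero : ∀ {n} (x : Pos n) j → x j ≡ 0 → mn x ≡ 0
mn-zero x j xj≡0 = n≤0⇒n≡0 (subst (mn x ≤_) xj≡0 (mn-≤ x j))

minFrom-const : ∀ {n} a → minFrom {n} a (λ _ → a) ≡ a
minFrom-const {zero} a = refl
minFrom-const {suc n} a rewrite ⊓-idem a = minFrom-const {n} a

fH-min-zero : ∀ {n} (h : Pos n → ℕ) x → mn x ≡ 0 → fH h x ≡ h x
fH-min-zero h x m≡0 rewrite m≡0 = refl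

-- At the all-ones position (V ≠ ∅), if the zero position has height 0 then
-- y = 1, m = 1 > C(1,2) = 0 and the formula gives v = 0.
fH-ones : ∀ {n} (h : Pos n → ℕ) → Fin n → h (λ _ → 0) ≡ 0 → fH h (λ _ → 1) ≡ 0
fH-ones {suc n} h _ h0≡0 rewrite minFrom-const {n} 1 | h0≡0 = refl

Terminal : ∀ {n} → Family n → Pos n → Set
Terminal ℋ x = ∀ x' → ¬ Move ℋ x x'

terminal⇒height-zero : ∀ {n} {ℋ : Family n} {h} → IsHeight ℋ h →
                        ∀ {x} → Terminal ℋ x → h x ≡ 0
terminal⇒height-zero {h = h} height {x} term with h x | proj₁ (height x)
... | zero  | _          = refl
... | suc _ | step mv _ = ⊥-elim (term _ mv)

height-zero⇒terminal : ∀ {n} {ℋ : Family n} {h} → IsHeight ℋ h →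
                        ∀ {x} → h x ≡ 0 → Terminal ℋ x
height-zero⇒terminal height {x} hx≡0 x' mv =
  n≮0 (subst (0 <_) hx≡0 (proj₂ (height x) 1 (step mv stop)))

move-edge-positive : ∀ {n} {x x' : Pos n} {E} →
  (∀ i → i ∈ E → x' i < x i) → ∀ i → i ∈ E → 0 < x i
move-edge-positive shrink i i∈E = <-≤-trans (s≤s z≤n) (shrink i i∈E)

move-keeps-zero : ∀ {n} {x x' : Pos n} {E} → (∀ i → i ∈ E → x' i < x i) →
  (∀ i → i ∉ E → x' i ≡ x i) → ∀ i → x i ≡ 0 → x' i ≡ 0
move-keeps-zero {E = E} shrink keep i xi≡0 with i ∈? E
... | yes i∈E = ⊥-elim (n≮0 (subst (_ <_) xi≡0 (shrink i i∈E)))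
... | no  i∉E = trans (keep i i∉E) xi≡0

-- A position vanishing on a transversal T is terminal: every hyperedge
-- contains a coordinate of T, which cannot decrease.
zero-on-transversal⇒terminal : ∀ {n} {ℋ : Family n} {T x} → IsTransversal ℋ T →
  (∀ i → i ∈ T → x i ≡ 0) → Terminal ℋ x
zero-on-transversal⇒terminal {T = T} transversal zeros x' (E , E∈ℋ , shrink , _)
  with transversal E E∈ℋ
... | i , i∈T∩E with x∈p∩q⁻ T E i∈T∩E
...   | i∈T , i∈E = n≮0 (subst (_ <_) (zeros i i∈T) (shrink i i∈E))

override : ∀ {n} → Subset n → ℕ → Pos n → Pos n
override H a x i with i ∈? H
... | yes _ = a
... | no  _ = x i

override-in : ∀ {n} H a (x : Pos n) i → i ∈ H → override H a x i ≡ a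
override-in H a x i i∈H with i ∈? H
... | yes _   = refl
... | no  i∉H = ⊥-elim (i∉H i∈H)

override-out : ∀ {n} H a (x : Pos n) i → i ∉ H → override H a x i ≡ x i
override-out H a x i i∉H with i ∈? H
... | yes i∈H = ⊥-elim (i∉H i∈H)
... | no  _   = refl

emptyOn : ∀ {n} → Subset n → Pos n → Pos n
emptyOn H = override H 0

emptyOn-move : ∀ {n} {ℋ : Family n} {H} x → H ∈ᴸ ℋ →
  (∀ i → i ∈ H → 0 < x i) → Move ℋ x (emptyOn H x)
emptyOn-move {H = H} x H∈ℋ pos =
  H , H∈ℋ , (λ i i∈H → subst (_< x i) (sym (override-in H 0 x i i∈H)) (pos i i∈H))
          , (λ i i∉H → override-out H 0 x i i∉H)

terminal⇒not-positive : ∀ {n} {ℋ : Family n} {x H} → Terminal ℋ x → H ∈ᴸ ℋ →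
  ¬ (∀ i → i ∈ H → 0 < x i)
terminal⇒not-positive {x = x} term H∈ℋ pos = term _ (emptyOn-move x H∈ℋ pos)

indicator : ∀ {n} → Subset n → Pos n
indicator S = override S 1 (λ _ → 0)

indicator-positive⇒∈ : ∀ {n} S i → 0 < indicator {n} S i → i ∈ S
indicator-positive⇒∈ S i pos with i ∈? S
... | yes i∈S = i∈S
... | no  _   = ⊥-elim (n≮0 pos)

indicator-positive : ∀ {n} {S H : Subset n} → H ⊆ S → ∀ i → i ∈ H → 0 < indicator S i
indicator-positive {S = S} H⊆S i i∈H =
  subst (0 <_) (sym (override-in S 1 _ i (H⊆S i∈H))) (s≤s z≤n)

-- If a move from 1_S along E reaches a terminal position, then E is an edge
-- of ℋ_S meeting every edge of ℋ_S: an edge of ℋ_S avoiding E would still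
-- carry only ones after the move, so it could be played.
terminal-move-from-indicator : ∀ {n} {ℋ : Family n} S {E x'} → E ∈ᴸ ℋ →
  (∀ i → i ∈ E → x' i < indicator S i) → (∀ i → i ∉ E → x' i ≡ indicator S i) →
  Terminal ℋ x' → E ∈ᴸ Induced ℋ S × IsTransversal (Induced ℋ S) E
terminal-move-from-indicator {ℋ = ℋ} S {E} {x'} E∈ℋ shrink keep terminal =
  ∈-filter⁺ (_⊆? S) E∈ℋ E⊆S , transversal
  where
  E⊆S : E ⊆ S
  E⊆S {i} i∈E = indicator-positive⇒∈ S i (move-edge-positive {x = indicator S} shrink i i∈E)
  transversal : IsTransversal (Induced ℋ S) E
  transversal H H∈ℋS with nonempty? (E ∩ H) | ∈-filter⁻ (_⊆? S) {xs = ℋ} H∈ℋS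
  ... | yes meets | _           = meets
  ... | no ¬meets | H∈ℋ , H⊆S = ⊥-elim (terminal⇒not-positive terminal H∈ℋ untouched)
    where
    untouched : ∀ i → i ∈ H → 0 < x' i
    untouched i i∈H with i ∈? E
    ... | yes i∈E = ⊥-elim (¬meets (i , x∈p∩q⁺ (i∈E , i∈H)))
    ... | no  i∉E = subst (0 <_) (sym (keep i i∉E)) (indicator-positive H⊆S i i∈H)

module JMHypergraph {n} {ℋ : Family n} {G h : Pos n → ℕ}
                    (sg : IsSG ℋ G) (height : IsHeight ℋ h)
                    (G≡f : ∀ x → G x ≡ fH h x) where

  -- On positions with a zero coordinate, G coincides with the height, so
  -- such a position has value 0 exactly when it is terminal.
  G≡h : ∀ x j → x j ≡ 0 → G x ≡ h x
  G≡h x j xj≡0 = trans (G≡f x) (fH-min-zero h x (mn-zero x j xj≡0))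

  -- Emptying a transversal hyperedge H from the all-ones position is a move
  -- between two positions of value 0.
  transversalFree : TransversalFree ℋ
  transversalFree (H , H∈ℋ , transversal) =
    proj₁ (sg ones) emptied (emptyOn-move ones H∈ℋ (λ _ _ → s≤s z≤n))
          (trans G-emptied≡0 (sym G-ones≡0))
    where
    ones : Pos n
    ones _ = 1
    emptied : Pos n
    emptied = emptyOn H ones
    vertex : Fin n
    vertex = proj₁ (transversal H H∈ℋ)
    vertex∈H : vertex ∈ H
    vertex∈H = proj₁ (x∈p∩q⁻ H H (proj₂ (transversal H H∈ℋ)))
    G-ones≡0 : G ones ≡ 0
    G-ones≡0 = trans (G≡f ones) (fH-ones h vertex (terminal⇒height-zero height
      (zero-on-transversal⇒terminal transversal (λ _ _ → refl))))
    G-emptied≡0 : G emptied ≡ 0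
    G-emptied≡0 = trans (G≡h emptied vertex (override-in H 0 ones vertex vertex∈H))
      (terminal⇒height-zero height
        (zero-on-transversal⇒terminal transversal (λ i → override-in H 0 ones i)))

  -- For S ≠ V, the position 1_S has a zero coordinate, so its value is its
  -- height, which is positive as soon as some edge of ℋ lies inside S.
  indicator-value-positive : ∀ {S H j} → j ∉ S → H ∈ᴸ ℋ → H ⊆ S → 0 < G (indicator S)
  indicator-value-positive {S} {j = j} j∉S H∈ℋ H⊆S =
    subst (0 <_) (sym (G≡h (indicator S) j (override-out S 1 _ j j∉S)))
      (proj₂ (height (indicator S)) 1
        (step (emptyOn-move (indicator S) H∈ℋ (indicator-positive H⊆S)) stop))

  -- Hence some move from 1_S reaches a position of value 0; it keeps the zero
  -- coordinate outside S, so it is terminal, and the edge of that move is a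
  -- transversal of ℋ_S lying in ℋ_S.
  inducedNotTransversalFree : ∀ S → S ⊂ ⊤ → (∃ λ H → H ∈ᴸ Induced ℋ S) →
                              ¬ TransversalFree (Induced ℋ S)
  inducedNotTransversalFree S (_ , j , _ , j∉S) (H₀ , H₀∈ℋS) free
    with ∈-filter⁻ (_⊆? S) {xs = ℋ} H₀∈ℋS
  ... | H₀∈ℋ , H₀⊆S
    with proj₂ (sg (indicator S)) 0 (indicator-value-positive j∉S H₀∈ℋ H₀⊆S)
  ... | x' , (E , E∈ℋ , shrink , keep) , Gx'≡0 =
    free (E , terminal-move-from-indicator S E∈ℋ shrink keep terminal)
    where
    terminal : Terminal ℋ x'
    terminal = height-zero⇒terminal height (trans
      (sym (G≡h x' j (move-keeps-zero shrink keep j (override-out S 1 _ j j∉S)))) Gx'≡0)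

lemma3p2 : ∀ (n : ℕ) (ℋ : Family n) → IsHypergraph ℋ → JM ℋ → MinimalTransversalFree ℋ
lemma3p2 n ℋ _ (G , h , sg , height , G≡f) = transversalFree , inducedNotTransversalFree
  where open JMHypergraph sg height G≡f
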